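{- If $G$ is a graph of order $n$, then $\mathcal{B}(G\cup K_3\cup K_1)=\sum_{k=1}^n (k^4+k^3+5k^2+6k+4)S(G,k)$ and $\mathcal{T}(G\cup K_3\cup K_1)=\sum_{k=1}^n (k^5+k^4+9k^3+15k^2+21k+13)S(G,k)$.
   Context: Graphs are finite and simple. For a graph $H$ of order $m$ and an integer $k$, $S(H,k)$ denotes the number of partitions of $V(H)$ into exactly $k$ nonempty stable sets; $\mathcal{B}(H)=\sum_{k=1}^m S(H,k)$ and $\mathcal{T}(H)=\sum_{k=1}^m kS(H,k)$. $\cup$ denotes disjoint union and $K_r$ the complete graph on $r$ vertices. -}

module Defs where

open import Data.Nat using (ℕ; zero; suc; _+_; _*_; _^_)
open import Data.Bool using (Bool; true; false; not; _∧_; _∨_; if_then_else_)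
open import Data.Fin using (Fin; zero; suc; _<?_; splitAt; _≟_)
open import Data.Sum using (inj₁; inj₂)
open import Data.List using (List; []; _∷_; map; concatMap)
open import Data.Bool.ListAction using (all; any)
open import Data.List using () renaming (allFin to finList)
open import Relation.Nullary.Decidable using (⌊_⌋; does)
open import Relation.Binary.PropositionalEquality using (_≡_; refl)
open import Relation.Nullary using (yes; no)
open import Data.Empty using (⊥-elim)
import Data.Bool as B

record Graph (n : ℕ) : Set where
  field
    adj    : Fin n → Fin n → Bool
    sym    : ∀ i j → adj i j ≡ adj j i
    irrefl : ∀ i → adj i i ≡ false
open Graph public

neq : ∀ {r} → Fin r → Fin r → Bool
neq i j = not ⌊ i ≟ j ⌋

private
  neq-sym : ∀ {r} (i j : Fin r) → neq i j ≡ neq j i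
  neq-sym i j with i ≟ j | j ≟ i
  ... | yes _ | yes _ = refl
  ... | no _  | no _  = refl
  ... | yes refl | no ¬p = ⊥-elim (¬p refl)
  ... | no ¬p | yes refl = ⊥-elim (¬p refl)

  neq-irrefl : ∀ {r} (i : Fin r) → neq i i ≡ false
  neq-irrefl i with i ≟ i
  ... | yes _ = refl
  ... | no ¬p = ⊥-elim (¬p refl)

K : (r : ℕ) → Graph r
K r = record { adj = neq ; sym = neq-sym ; irrefl = neq-irrefl }

unionAdj : ∀ {m n} → Graph m → Graph n → Fin (m + n) → Fin (m + n) → Bool
unionAdj {m} G H i j with splitAt m i | splitAt m j
... | inj₁ a | inj₁ b = adj G a b
... | inj₂ a | inj₂ b = adj H a b
... | inj₁ _ | inj₂ _ = false
... | inj₂ _ | inj₁ _ = false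

private
  unionSym : ∀ {m n} (G : Graph m) (H : Graph n) i j → unionAdj G H i j ≡ unionAdj G H j i
  unionSym {m} G H i j with splitAt m i | splitAt m j
  ... | inj₁ a | inj₁ b = sym G a b
  ... | inj₂ a | inj₂ b = sym H a b
  ... | inj₁ _ | inj₂ _ = refl
  ... | inj₂ _ | inj₁ _ = refl

  unionIrr : ∀ {m n} (G : Graph m) (H : Graph n) i → unionAdj G H i i ≡ false
  unionIrr {m} G H i with splitAt m i
  ... | inj₁ a = irrefl G a
  ... | inj₂ a = irrefl H a

infixl 6 _∪_
_∪_ : ∀ {m n} → Graph m → Graph n → Graph (m + n)
G ∪ H = record { adj = unionAdj G H ; sym = unionSym G H ; irrefl = unionIrr G H }

consF : ∀ {n k} → Fin k → (Fin n → Fin k) → Fin (suc n) → Fin k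
consF a f zero    = a
consF a f (suc i) = f i

allFuns : (n k : ℕ) → List (Fin n → Fin k)
allFuns zero    k = (λ ()) ∷ []
allFuns (suc n) k = concatMap (λ f → map (λ a → consF a f) (finList k)) (allFuns n k)

-- A partition of V(H) = Fin m into exactly k nonempty blocks is encoded
-- canonically by a labelling c : Fin m → Fin k such that
--   * every label is used (blocks nonempty, exactly k blocks), and
--   * blocks are labelled in order of their least element: whenever
--     c i = l and j < l, label j already occurs at some vertex i' < i.
-- This is a bijection between such labellings and such partitions.
eqF : ∀ {k} → Fin k → Fin k → Bool
eqF a b = ⌊ a ≟ b ⌋

ltF : ∀ {k} → Fin k → Fin k → Bool
ltF a b = ⌊ a <? b ⌋

surjective? : ∀ {m k} → (Fin m → Fin k) → Bool
surjective? {m} {k} c = all (λ j → any (λ i → eqF (c i) j) (finList m)) (finList k)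

canonical? : ∀ {m k} → (Fin m → Fin k) → Bool
canonical? {m} {k} c =
  all (λ i → all (λ j → not (ltF j (c i)) ∨ any (λ i' → ltF i' i ∧ eqF (c i') j) (finList m)) (finList k)) (finList m)

stableBlocks? : ∀ {m k} → Graph m → (Fin m → Fin k) → Bool
stableBlocks? {m} H c =
  all (λ i → all (λ i' → not (adj H i i' ∧ eqF (c i) (c i'))) (finList m)) (finList m)

isStablePartition : ∀ {m k} → Graph m → (Fin m → Fin k) → Bool
isStablePartition H c = surjective? c ∧ canonical? c ∧ stableBlocks? H c

S : ∀ {m} → Graph m → ℕ → ℕ
S {m} H k = count (allFuns m k)
  where
  count : List (Fin m → Fin k) → ℕ
  count [] = 0
  count (c ∷ cs) = (if isStablePartition H c then 1 else 0) + count cs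

sum1to : ℕ → (ℕ → ℕ) → ℕ
sum1to zero    f = 0
sum1to (suc n) f = sum1to n f + f (suc n)

𝓑 : ∀ {m} → Graph m → ℕ
𝓑 {m} H = sum1to m (λ k → S H k)

𝓣 : ∀ {m} → Graph m → ℕ
𝓣 {m} H = sum1to m (λ k → k * S H k)

{-# OPTIONS --safe #-}
module Submission where

-- Let v be the last vertex of a graph H′, H = H′ − v, and let the neighbours of v form a clique
-- of d vertices. A stable partition of H′ into k + 1 blocks either has {v} as a block, leaving a
-- stable partition of H into k blocks, or puts v into one of the k + 1 blocks of a stable
-- partition of H that contain no neighbour of v; the d neighbours lie in d different blocks, so
--   S(H′, k + 1) = S(H, k) + (k + 1 − d) S(H, k + 1).
-- In the labelling encoding of `Defs` (restricted growth strings) v comes last, so a singleton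
-- block {v} carries the top label. Removing the vertices of G ∪ K₃ ∪ K₁ from the end gives
-- d = 0, 2, 1, 0, and each removal turns Σⱼ w(j) S(H′, j) into Σₖ (w(k + 1) + (k − d) w(k)) S(H, k).
-- Four removals, starting from w = 1 and from w(j) = j, give the two polynomials.

open import Defs hiding (sym)
open import Data.Nat as ℕ using (ℕ; zero; suc; _+_; _*_; _^_; _≤_; _∸_; pred)
open import Data.Nat.Properties
  using (+-identityʳ; +-assoc; +-comm; +-suc; *-comm; *-assoc; *-zeroʳ; *-identityˡ; *-distribˡ-+; *-distribʳ-+;
         m+n∸n≡m; n<1+n; +-*-semiring; +-commutativeSemigroup; ≤⇒≯)
open import Data.Nat.Solver using (module +-*-Solver)
open import Algebra.Properties.CommutativeSemigroup +-commutativeSemigroup using (interchange)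
open import Data.Fin.Properties
  using (suc-injective; toℕ-inject₁; toℕ-fromℕ; inject₁ℕ<; ≤fromℕ; <⇒≢; <-irrefl; ≤∧≢⇒<; cast-is-id;
         pigeonhole; inject₁-injective; fromℕ≢inject₁; ¬∀⟶∃¬; any?; toℕ-injective; toℕ-cast;
         toℕ-↑ˡ; toℕ-↑ʳ; splitAt-↑ˡ; splitAt-↑ʳ; splitAt⁻¹-↑ˡ; splitAt⁻¹-↑ʳ)
import Data.Nat.ListAction as List
open import Data.Nat.ListAction.Properties using (sum-++)
open import Data.Product using (_×_; _,_; proj₁; proj₂; ∃)
open import Data.Bool using (Bool; true; false; not; _∧_; _∨_; T; if_then_else_)
open import Data.Bool.Properties using (T-∧)
open import Data.Bool.ListAction using (all; any; and; or)
open import Data.Empty using (⊥-elim)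
open import Data.Sum using (_⊎_; inj₁; inj₂)
open import Data.Fin using (Fin; zero; suc; _<_; _≟_; toℕ; inject₁; fromℕ; cast; _↑ˡ_; _↑ʳ_; splitAt)
open import Data.List using (List; []; _∷_; map; _++_; concatMap; allFin; tabulate; length)
open import Data.List.Properties using (map-++; map-cong; map-tabulate; length-map; length-tabulate)
open import Data.List.Membership.Propositional using (_∈_; _∉_)
open import Data.List.Membership.Propositional.Properties using (∈-map⁺; ∈-map⁻; ∈-tabulate⁺; ∈-tabulate⁻)
import Data.List.Membership.DecPropositional as DecMembership
open import Data.List.Relation.Unary.All.Properties using (All¬⇒¬Any)
open import Data.List.Relation.Unary.AllPairs as AllPairs using (AllPairs; []; _∷_)
import Data.List.Relation.Unary.AllPairs.Properties as AllPairs
open import Data.List.Relation.Unary.Unique.Propositional using (Unique)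
import Data.List.Relation.Unary.All.Properties as All
import Data.List.Relation.Unary.Any.Properties as Any
open import Function using (_∘_; _⇔_; mk⇔; Equivalence)
open import Data.Fin.Relation.Unary.Top using (view; ‵fromℕ; ‵inject₁)
open import Relation.Binary.Core using (_Preserves_⟶_)
open import Relation.Binary.PropositionalEquality
  using (_≡_; _≢_; _≗_; refl; sym; trans; cong; cong₂; subst; subst₂; module ≡-Reasoning)
open import Relation.Nullary using (¬_; Dec; does; yes; no)
open import Relation.Nullary.Decidable using (toWitness; fromWitness; map′; T?; isYes≗does; dec-true; dec-false)
open import Algebra.Properties.Semiring.Sum +-*-semiring
  using (sum-syntax; sum-cong-≗; ∑-distrib-+; ∑-comm; sum-init-last; sum-replicate-zero; *-distribˡ-sum)

open Equivalence using (to; from)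

ind : Bool → ℕ
ind b = if b then 1 else 0

T-ext : ∀ {x y} → (T x → T y) → (T y → T x) → x ≡ y
T-ext {false} {false} _ _ = refl
T-ext {false} {true}  _ g = ⊥-elim (g _)
T-ext {true}  {false} f _ = ⊥-elim (f _)
T-ext {true}  {true}  _ _ = refl

ind-false : ∀ {x} → ¬ T x → ind x ≡ 0
ind-false {false} _  = refl
ind-false {true}  ¬t = ⊥-elim (¬t _)

ind-cong : ∀ {x y} → T x ⇔ T y → ind x ≡ ind y
ind-cong x⇔y = cong ind (T-ext (to x⇔y) (from x⇔y))

ind-∧ : ∀ x y → ind (x ∧ y) ≡ ind x * ind y
ind-∧ false y = refl
ind-∧ true  y = sym (+-identityʳ (ind y))

ind-*-cong : ∀ {x y z} → (T x → y ≡ z) → ind x * y ≡ ind x * z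
ind-*-cong {false} _   = refl
ind-*-cong {true}  y≡z = cong (_+ 0) (y≡z _)

T-does : ∀ {A : Set} (a? : Dec A) → T (does a?) ⇔ A
T-does a? = mk⇔ (λ t → toWitness (subst T (sym (isYes≗does a?)) t)) (λ a → subst T (isYes≗does a?) (fromWitness a))

T-not : ∀ {x} → T (not x) ⇔ (¬ T x)
T-not {false} = mk⇔ (λ _ ()) (λ _ → _)
T-not {true}  = mk⇔ (λ ()) (λ ¬t → ¬t _)

T-⇒ : ∀ {x y} → T (not x ∨ y) ⇔ (T x → T y)
T-⇒ {false} = mk⇔ (λ _ ()) (λ _ → _)
T-⇒ {true}  = mk⇔ (λ t _ → t) (λ f → f _)

T-all-allFin : ∀ {n} (p : Fin n → Bool) → T (all p (allFin n)) ⇔ (∀ i → T (p i))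
T-all-allFin p = mk⇔ (All.tabulate⁻ ∘ All.all⁺ p _) (All.all⁻ p ∘ All.tabulate⁺)

T-any-allFin : ∀ {n} (p : Fin n → Bool) → T (any p (allFin n)) ⇔ (∃ λ i → T (p i))
T-any-allFin p = mk⇔ (Any.tabulate⁻ ∘ Any.any⁻ p _) (λ (i , t) → Any.any⁺ p (Any.tabulate⁺ i t))

-- Stable partitions

Onto : ∀ {m k} → (Fin m → Fin k) → Set
Onto c = ∀ l → ∃ λ i → c i ≡ l

RestrictedGrowth : ∀ {m k} → (Fin m → Fin k) → Set
RestrictedGrowth c = ∀ i l → l < c i → ∃ λ i′ → i′ < i × c i′ ≡ l

Proper : ∀ {m k} → Graph m → (Fin m → Fin k) → Set
Proper H c = ∀ i j → T (adj H i j) → c i ≢ c j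

StablePartition : ∀ {m k} → Graph m → (Fin m → Fin k) → Set
StablePartition H c = Onto c × RestrictedGrowth c × Proper H c

onto-reflects : ∀ {m k} (c : Fin m → Fin k) → T (surjective? c) ⇔ Onto c
onto-reflects c = mk⇔
  (λ t l → let i , e = to (T-any-allFin _) (to (T-all-allFin _) t l) in i , toWitness e)
  (λ h → from (T-all-allFin _) λ l → let i , e = h l in from (T-any-allFin _) (i , fromWitness e))

restrictedGrowth-reflects : ∀ {m k} (c : Fin m → Fin k) → T (canonical? c) ⇔ RestrictedGrowth c
restrictedGrowth-reflects c = mk⇔ to′ from′
  where
  to′ : T (canonical? c) → RestrictedGrowth c
  to′ t i l l<ci =
    let below⇒earlier = to (T-all-allFin _) (to (T-all-allFin _) t i) l
        i′ , u = to (T-any-allFin _) (to (T-⇒ {ltF l (c i)}) below⇒earlier (fromWitness l<ci))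
        i′<i , e = to (T-∧ {ltF i′ i}) u
    in i′ , toWitness i′<i , toWitness e

  from′ : RestrictedGrowth c → T (canonical? c)
  from′ h = from (T-all-allFin _) λ i → from (T-all-allFin _) λ l → from (T-⇒ {ltF l (c i)}) λ l<ci →
    let i′ , i′<i , e = h i l (toWitness l<ci)
    in from (T-any-allFin _) (i′ , from (T-∧ {ltF i′ i}) (fromWitness i′<i , fromWitness e))

proper-reflects : ∀ {m k} (H : Graph m) (c : Fin m → Fin k) → T (stableBlocks? H c) ⇔ Proper H c
proper-reflects H c = mk⇔
  (λ t i j a e → to T-not (to (T-all-allFin _) (to (T-all-allFin _) t i) j)
                          (from (T-∧ {adj H i j}) (a , fromWitness e)))
  (λ h → from (T-all-allFin _) λ i → from (T-all-allFin _) λ j → from T-not λ u →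
    let a , e = to (T-∧ {adj H i j}) u in h i j a (toWitness e))

stablePartition-reflects : ∀ {m k} (H : Graph m) (c : Fin m → Fin k) →
                           T (isStablePartition H c) ⇔ StablePartition H c
stablePartition-reflects H c = mk⇔
  (λ t → let o , u = to T-∧ t ; g , p = to T-∧ u in
         to (onto-reflects c) o , to (restrictedGrowth-reflects c) g , to (proper-reflects H c) p)
  (λ (o , g , p) → from T-∧ (from (onto-reflects c) o ,
                   from T-∧ (from (restrictedGrowth-reflects c) g , from (proper-reflects H c) p)))

all-cong : ∀ {A : Set} {p q : A → Bool} → p ≗ q → ∀ xs → all p xs ≡ all q xs
all-cong p≗q xs = cong and (map-cong p≗q xs)

any-cong : ∀ {A : Set} {p q : A → Bool} → p ≗ q → ∀ xs → any p xs ≡ any q xs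
any-cong p≗q xs = cong or (map-cong p≗q xs)

surjective?-cong : ∀ {m k} {c d : Fin m → Fin k} → c ≗ d → surjective? c ≡ surjective? d
surjective?-cong c≗d = all-cong (λ l → any-cong (λ i → cong (λ x → eqF x l) (c≗d i)) (allFin _)) (allFin _)

isStablePartition-cong : ∀ {m k} {H H′ : Graph m} {c d : Fin m → Fin k} →
                         (∀ i j → adj H i j ≡ adj H′ i j) → c ≗ d →
                         isStablePartition H c ≡ isStablePartition H′ d
isStablePartition-cong {m} {k} {H} {H′} {c} {d} adj≡ c≗d =
  cong₂ _∧_ (surjective?-cong c≗d) (cong₂ _∧_ canonical≡ stable≡)
  where
  canonical≡ : canonical? c ≡ canonical? d
  canonical≡ = all-cong (λ i → all-cong (λ l → cong₂ _∨_ (cong (λ x → not (ltF l x)) (c≗d i))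
    (any-cong (λ i′ → cong (λ x → ltF i′ i ∧ eqF x l) (c≗d i′)) (allFin m))) (allFin k)) (allFin m)

  stable≡ : stableBlocks? H c ≡ stableBlocks? H′ d
  stable≡ = all-cong (λ i → all-cong (λ j →
    cong not (cong₂ _∧_ (adj≡ i j) (cong₂ eqF (c≗d i) (c≗d j)))) (allFin m)) (allFin m)

ind-isStablePartition-cong : ∀ {m k} (H : Graph m) →
                             (ind ∘ isStablePartition {k = k} H) Preserves _≗_ ⟶ _≡_
ind-isStablePartition-cong H c≗d = cong ind (isStablePartition-cong {H = H} {H′ = H} (λ _ _ → refl) c≗d)

∑-single : ∀ {n} (F : Fin n → ℕ) b → (∀ a → a ≢ b → F a ≡ 0) → ∑[ a < n ] F a ≡ F b
∑-single {suc n} F zero vanish = trans (cong (F zero +_) rest) (+-identityʳ (F zero))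
  where
  rest : ∑[ a < n ] F (suc a) ≡ 0
  rest = trans (sum-cong-≗ (λ a → vanish (suc a) λ ())) (sum-replicate-zero n)
∑-single {suc n} F (suc b) vanish =
  trans (cong (_+ ∑[ a < n ] F (suc a)) (vanish zero λ ()))
        (∑-single (F ∘ suc) b λ a a≢b → vanish (suc a) (a≢b ∘ suc-injective))

∑-ones : ∀ n → ∑[ a < n ] 1 ≡ n
∑-ones zero    = refl
∑-ones (suc n) = cong suc (∑-ones n)

_∉?_ : ∀ {K} (a : Fin K) (ls : List (Fin K)) → Dec (a ∉ ls)
_∉?_ = DecMembership._∉?_ _≟_

∑-∉ : ∀ {K} (ls : List (Fin K)) → Unique ls → ∑[ a < K ] ind (does (a ∉? ls)) + length ls ≡ K
∑-∉ {K} []       []                = trans (+-identityʳ _) (∑-ones K)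
∑-∉ {K} (l ∷ ls) (l∉ls ∷ unique) = begin
  ∑[ a < K ] outside a + (1 + length ls)
    ≡⟨ cong (λ n → ∑[ a < K ] outside a + (n + length ls)) hit-once ⟨
  ∑[ a < K ] outside a + (∑[ a < K ] hit a + length ls)
    ≡⟨ +-assoc (∑[ a < K ] outside a) (∑[ a < K ] hit a) (length ls) ⟨
  ∑[ a < K ] outside a + ∑[ a < K ] hit a + length ls
    ≡⟨ cong (_+ length ls) (∑-distrib-+ outside hit) ⟨
  ∑[ a < K ] (outside a + hit a) + length ls
    ≡⟨ cong (_+ length ls) (sum-cong-≗ split) ⟩
  ∑[ a < K ] ind (does (a ∉? ls)) + length ls
    ≡⟨ ∑-∉ ls unique ⟩
  K ∎
  where
  open ≡-Reasoning
  outside hit : Fin K → ℕ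
  outside a = ind (does (a ∉? (l ∷ ls)))
  hit     a = ind (does (a ≟ l))

  hit-once : ∑[ a < K ] hit a ≡ 1
  hit-once = trans (∑-single hit l λ a a≢l → cong ind (dec-false (a ≟ l) a≢l)) (cong ind (dec-true (l ≟ l) refl))

  split : ∀ a → outside a + hit a ≡ ind (does (a ∉? ls))
  split a with a ≟ l
  ... | yes refl rewrite dec-true (a ∉? ls) (All¬⇒¬Any l∉ls) = refl
  ... | no  _    = +-identityʳ _

-- `S` counts with a function local to its definition, reachable only through its defining equations;
-- `S≡listSum` instantiates `count` with it by abstracting over the list `allFuns m k`.
count≡sum : ∀ {A : Set} (p : A → Bool) (count : List A → ℕ) →
            count [] ≡ 0 → (∀ x xs → count (x ∷ xs) ≡ ind (p x) + count xs) →
            ∀ xs → count xs ≡ List.sum (map (ind ∘ p) xs)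
count≡sum p count nil cons []       = nil
count≡sum p count nil cons (x ∷ xs) = trans (cons x xs) (cong (ind (p x) +_) (count≡sum p count nil cons xs))

sum-map-concatMap : ∀ {A B : Set} (φ : B → ℕ) (h : A → List B) xs →
                    List.sum (map φ (concatMap h xs)) ≡ List.sum (map (List.sum ∘ map φ ∘ h) xs)
sum-map-concatMap φ h []       = refl
sum-map-concatMap φ h (x ∷ xs) = begin
  List.sum (map φ (h x ++ concatMap h xs))                    ≡⟨ cong List.sum (map-++ φ (h x) _) ⟩
  List.sum (map φ (h x) ++ map φ (concatMap h xs))            ≡⟨ sum-++ (map φ (h x)) _ ⟩
  List.sum (map φ (h x)) + List.sum (map φ (concatMap h xs))  ≡⟨ cong (_ +_) (sum-map-concatMap φ h xs) ⟩
  List.sum (map φ (h x)) + List.sum (map (List.sum ∘ map φ ∘ h) xs) ∎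
  where open ≡-Reasoning

sum-map-tabulate : ∀ {A : Set} {n} (φ : A → ℕ) (g : Fin n → A) →
                   List.sum (map φ (tabulate g)) ≡ ∑[ i < n ] φ (g i)
sum-map-tabulate {n = zero}  φ g = refl
sum-map-tabulate {n = suc n} φ g = cong (φ (g zero) +_) (sum-map-tabulate φ (g ∘ suc))

sumFuns : ∀ m k → ((Fin m → Fin k) → ℕ) → ℕ
sumFuns zero    k F = F (λ ())
sumFuns (suc m) k F = sumFuns m k (λ f → ∑[ a < k ] F (consF a f))

consF-cong : ∀ {m k} (a : Fin k) {f g : Fin m → Fin k} → f ≗ g → consF a f ≗ consF a g
consF-cong a f≗g zero    = refl
consF-cong a f≗g (suc i) = f≗g i

sum-allFuns : ∀ m k {F : (Fin m → Fin k) → ℕ} → F Preserves _≗_ ⟶ _≡_ →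
              List.sum (map F (allFuns m k)) ≡ sumFuns m k F
sum-allFuns zero    k F-cong = trans (+-identityʳ _) (F-cong λ ())
sum-allFuns (suc m) k {F} F-cong = begin
  List.sum (map F (allFuns (suc m) k))
    ≡⟨ sum-map-concatMap F (λ f → map (λ a → consF a f) (allFin k)) (allFuns m k) ⟩
  List.sum (map (λ f → List.sum (map F (map (λ a → consF a f) (allFin k)))) (allFuns m k))
    ≡⟨ cong List.sum (map-cong sum-consF (allFuns m k)) ⟩
  List.sum (map (λ f → ∑[ a < k ] F (consF a f)) (allFuns m k))
    ≡⟨ sum-allFuns m k (λ f≗g → sum-cong-≗ λ a → F-cong (consF-cong a f≗g)) ⟩
  sumFuns (suc m) k F ∎
  where
  open ≡-Reasoning
  sum-consF : ∀ f → List.sum (map F (map (λ a → consF a f) (allFin k))) ≡ ∑[ a < k ] F (consF a f)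
  sum-consF f = trans (cong (List.sum ∘ map F) (map-tabulate (λ a → a) (λ a → consF a f)))
                      (sum-map-tabulate F (λ a → consF a f))

S≡listSum : ∀ {m} (H : Graph m) k → S H k ≡ List.sum (map (ind ∘ isStablePartition H) (allFuns m k))
S≡listSum {m} H k with count≡sum (isStablePartition H) _ refl (λ _ _ → refl) | allFuns m k
... | count≡ | cs = count≡ cs

S≡sumFuns : ∀ {m} (H : Graph m) k → S H k ≡ sumFuns m k (ind ∘ isStablePartition H)
S≡sumFuns {m} H k =
  trans (S≡listSum H k) (sum-allFuns m k (ind-isStablePartition-cong H))

sumFuns-cong : ∀ m k {F G : (Fin m → Fin k) → ℕ} → (∀ f → F f ≡ G f) → sumFuns m k F ≡ sumFuns m k G
sumFuns-cong zero    k F≡G = F≡G _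
sumFuns-cong (suc m) k F≡G = sumFuns-cong m k λ f → sum-cong-≗ λ a → F≡G (consF a f)

sumFuns-+ : ∀ m k (F G : (Fin m → Fin k) → ℕ) →
            sumFuns m k (λ f → F f + G f) ≡ sumFuns m k F + sumFuns m k G
sumFuns-+ zero    k F G = refl
sumFuns-+ (suc m) k F G =
  trans (sumFuns-cong m k λ f → ∑-distrib-+ (λ a → F (consF a f)) (λ a → G (consF a f))) (sumFuns-+ m k _ _)

sumFuns-*ˡ : ∀ m k c (F : (Fin m → Fin k) → ℕ) → sumFuns m k (λ f → c * F f) ≡ c * sumFuns m k F
sumFuns-*ˡ zero    k c F = refl
sumFuns-*ˡ (suc m) k c F =
  trans (sumFuns-cong m k λ f → sym (*-distribˡ-sum c (λ a → F (consF a f)))) (sumFuns-*ˡ m k c _)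

sumFuns-zero : ∀ m k {F : (Fin m → Fin k) → ℕ} → (∀ f → F f ≡ 0) → sumFuns m k F ≡ 0
sumFuns-zero zero    k F≡0 = F≡0 _
sumFuns-zero (suc m) k F≡0 =
  sumFuns-zero m k λ f → trans (sum-cong-≗ λ a → F≡0 (consF a f)) (sum-replicate-zero k)

reindex : ∀ {m n} → (Fin m → Fin n) → Graph n → Graph m
reindex φ H = record
  { adj    = λ i j → adj H (φ i) (φ j)
  ; sym    = λ i j → Graph.sym H (φ i) (φ j)
  ; irrefl = λ i → irrefl H (φ i)
  }

deleteLast : ∀ {m} → Graph (suc m) → Graph m
deleteLast = reindex inject₁

S-cong : ∀ {m} {H H′ : Graph m} → (∀ i j → adj H i j ≡ adj H′ i j) → ∀ k → S H k ≡ S H′ k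
S-cong {m} {H} {H′} adj≡ k = begin
  S H k                                     ≡⟨ S≡sumFuns H k ⟩
  sumFuns m k (ind ∘ isStablePartition H)   ≡⟨ sumFuns-cong m k same-blocks ⟩
  sumFuns m k (ind ∘ isStablePartition H′)  ≡⟨ S≡sumFuns H′ k ⟨
  S H′ k                                    ∎
  where
  open ≡-Reasoning
  same-blocks : ∀ f → ind (isStablePartition H f) ≡ ind (isStablePartition H′ f)
  same-blocks f = cong ind (isStablePartition-cong {H = H} {H′} {f} {f} adj≡ λ _ → refl)

S-reindex-cast : ∀ {m n} (m≡n : m ≡ n) (H : Graph n) k → S (reindex (cast m≡n) H) k ≡ S H k
S-reindex-cast refl H = S-cong λ i j → cong₂ (adj H) (cast-is-id refl i) (cast-is-id refl j)

S-zero : ∀ {m} (H : Graph (suc m)) → S H 0 ≡ 0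
S-zero {m} H = trans (S≡sumFuns H 0) (sumFuns-zero m 0 λ _ → refl)

S-beyond : ∀ {m} (H : Graph m) k → m ℕ.< k → S H k ≡ 0
S-beyond {m} H k m<k = trans (S≡sumFuns H k) (sumFuns-zero m k λ f →
  ind-false λ t → not-onto f (proj₁ (to (stablePartition-reflects H f) t)))
  where
  not-onto : (f : Fin m → Fin k) → ¬ Onto f
  not-onto f onto =
    let l , l′ , l<l′ , same-preimage = pigeonhole m<k (proj₁ ∘ onto)
        l≡l′ = trans (sym (proj₂ (onto l))) (trans (cong f same-preimage) (proj₂ (onto l′)))
    in <⇒≢ l<l′ l≡l′

infixl 5 _∷ʳ_

_∷ʳ_ : ∀ {m} {A : Set} → (Fin m → A) → A → Fin (suc m) → A
_∷ʳ_ {zero}  f a zero    = a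
_∷ʳ_ {suc m} f a zero    = f zero
_∷ʳ_ {suc m} f a (suc i) = (f ∘ suc ∷ʳ a) i

∷ʳ-inject₁ : ∀ {m} {A : Set} (f : Fin m → A) a i → (f ∷ʳ a) (inject₁ i) ≡ f i
∷ʳ-inject₁ {suc m} f a zero    = refl
∷ʳ-inject₁ {suc m} f a (suc i) = ∷ʳ-inject₁ (f ∘ suc) a i

∷ʳ-fromℕ : ∀ {m} {A : Set} (f : Fin m → A) a → (f ∷ʳ a) (fromℕ m) ≡ a
∷ʳ-fromℕ {zero}  f a = refl
∷ʳ-fromℕ {suc m} f a = ∷ʳ-fromℕ (f ∘ suc) a

∷ʳ-cong : ∀ {m} {A : Set} {f g : Fin m → A} a → f ≗ g → f ∷ʳ a ≗ g ∷ʳ a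
∷ʳ-cong {zero}  a f≗g zero    = refl
∷ʳ-cong {suc m} a f≗g zero    = f≗g zero
∷ʳ-cong {suc m} a f≗g (suc i) = ∷ʳ-cong a (f≗g ∘ suc) i

consF-∷ʳ : ∀ {m k} (b : Fin k) (f : Fin m → Fin k) a → consF b (f ∷ʳ a) ≗ consF b f ∷ʳ a
consF-∷ʳ b f a zero    = refl
consF-∷ʳ b f a (suc i) = refl

consF-∷ʳ-empty : ∀ {k} (a : Fin k) (f : Fin 0 → Fin k) → consF a f ≗ f ∷ʳ a
consF-∷ʳ-empty a f zero = refl

consF-inject₁ : ∀ {m k} (b : Fin k) (g : Fin m → Fin k) →
                consF (inject₁ b) (inject₁ ∘ g) ≗ inject₁ ∘ consF b g
consF-inject₁ b g zero    = refl
consF-inject₁ b g (suc i) = refl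

sumFuns-∷ʳ : ∀ m k {F : (Fin (suc m) → Fin k) → ℕ} → F Preserves _≗_ ⟶ _≡_ →
             sumFuns (suc m) k F ≡ sumFuns m k (λ f → ∑[ a < k ] F (f ∷ʳ a))
sumFuns-∷ʳ zero    k F-cong = sum-cong-≗ λ a → F-cong (consF-∷ʳ-empty a _)
sumFuns-∷ʳ (suc m) k {F} F-cong = begin
  sumFuns (suc m) k (λ g → ∑[ b < k ] F (consF b g))
    ≡⟨ sumFuns-∷ʳ m k (λ g≗h → sum-cong-≗ λ b → F-cong (consF-cong b g≗h)) ⟩
  sumFuns m k (λ f → ∑[ a < k ] ∑[ b < k ] F (consF b (f ∷ʳ a)))
    ≡⟨ sumFuns-cong m k (λ f → ∑-comm λ a b → F (consF b (f ∷ʳ a))) ⟩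
  sumFuns m k (λ f → ∑[ b < k ] ∑[ a < k ] F (consF b (f ∷ʳ a)))
    ≡⟨ sumFuns-cong m k (λ f → sum-cong-≗ λ b → sum-cong-≗ λ a → F-cong (consF-∷ʳ b f a)) ⟩
  sumFuns m k (λ f → ∑[ b < k ] ∑[ a < k ] F (consF b f ∷ʳ a)) ∎
  where open ≡-Reasoning

sumFuns-inject₁ : ∀ m k {F : (Fin m → Fin (suc k)) → ℕ} → F Preserves _≗_ ⟶ _≡_ →
                  (∀ f i → f i ≡ fromℕ k → F f ≡ 0) →
                  sumFuns m (suc k) F ≡ sumFuns m k (λ g → F (inject₁ ∘ g))
sumFuns-inject₁ zero    k F-cong F-vanish = F-cong λ ()
sumFuns-inject₁ (suc m) k {F} F-cong F-vanish = begin
  sumFuns m (suc k) (λ f → ∑[ a < suc k ] F (consF a f))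
    ≡⟨ sumFuns-cong m (suc k) drop-last ⟩
  sumFuns m (suc k) (λ f → ∑[ b < k ] F (consF (inject₁ b) f))
    ≡⟨ sumFuns-inject₁ m k (λ f≗g → sum-cong-≗ λ b → F-cong (consF-cong (inject₁ b) f≗g)) vanish ⟩
  sumFuns m k (λ g → ∑[ b < k ] F (consF (inject₁ b) (inject₁ ∘ g)))
    ≡⟨ sumFuns-cong m k (λ g → sum-cong-≗ λ b → F-cong (consF-inject₁ b g)) ⟩
  sumFuns m k (λ g → ∑[ b < k ] F (inject₁ ∘ consF b g)) ∎
  where
  open ≡-Reasoning
  vanish : ∀ f i → f i ≡ fromℕ k → ∑[ b < k ] F (consF (inject₁ b) f) ≡ 0
  vanish f i fi≡top = trans (sum-cong-≗ λ b → F-vanish (consF (inject₁ b) f) (suc i) fi≡top) (sum-replicate-zero k)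

  drop-last : ∀ f → ∑[ a < suc k ] F (consF a f) ≡ ∑[ b < k ] F (consF (inject₁ b) f)
  drop-last f = trans (sum-init-last (λ a → F (consF a f)))
                      (trans (cong (∑[ b < k ] F (consF (inject₁ b) f) +_) (F-vanish _ zero refl)) (+-identityʳ _))

inject₁-<-inject₁ : ∀ {n} {i j : Fin n} → inject₁ i < inject₁ j ⇔ i < j
inject₁-<-inject₁ {i = i} {j} = mk⇔ (subst₂ ℕ._<_ (toℕ-inject₁ i) (toℕ-inject₁ j))
                                    (subst₂ ℕ._<_ (sym (toℕ-inject₁ i)) (sym (toℕ-inject₁ j)))

inject₁<fromℕ : ∀ {n} (i : Fin n) → inject₁ i < fromℕ n
inject₁<fromℕ {n} i = subst (toℕ (inject₁ i) ℕ.<_) (sym (toℕ-fromℕ n)) (inject₁ℕ< i)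

fromℕ≮ : ∀ {n} (i : Fin (suc n)) → ¬ fromℕ n < i
fromℕ≮ i = ≤⇒≯ (≤fromℕ i)

Free : ∀ {m k} → Graph (suc m) → (Fin m → Fin k) → Fin k → Set
Free {m} H′ f a = ∀ i → T (adj H′ (fromℕ m) (inject₁ i)) → f i ≢ a

module _ {m k} {f : Fin m → Fin k} {a : Fin k} where

  onto-∷ʳ : Onto (f ∷ʳ a) ⇔ (∀ l → (∃ λ i → f i ≡ l) ⊎ a ≡ l)
  onto-∷ʳ = mk⇔ to′ from′
    where
    to′ : Onto (f ∷ʳ a) → ∀ l → (∃ λ i → f i ≡ l) ⊎ a ≡ l
    to′ onto l with onto l
    ... | i , e with view i
    ...   | ‵fromℕ     = inj₂ (trans (sym (∷ʳ-fromℕ f a)) e)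
    ...   | ‵inject₁ j = inj₁ (j , trans (sym (∷ʳ-inject₁ f a j)) e)

    from′ : (∀ l → (∃ λ i → f i ≡ l) ⊎ a ≡ l) → Onto (f ∷ʳ a)
    from′ h l with h l
    ... | inj₁ (i , e) = inject₁ i , trans (∷ʳ-inject₁ f a i) e
    ... | inj₂ e       = fromℕ m , trans (∷ʳ-fromℕ f a) e

  restrictedGrowth-∷ʳ : RestrictedGrowth (f ∷ʳ a) ⇔ (RestrictedGrowth f × (∀ l → l < a → ∃ λ i → f i ≡ l))
  restrictedGrowth-∷ʳ = mk⇔ (λ growth → growth-init growth , growth-last growth) from′
    where
    growth-init : RestrictedGrowth (f ∷ʳ a) → RestrictedGrowth f
    growth-init growth i l l<fi with growth (inject₁ i) l (subst (l <_) (sym (∷ʳ-inject₁ f a i)) l<fi)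
    ... | i′ , i′<i , e with view i′
    ...   | ‵fromℕ     = ⊥-elim (fromℕ≮ (inject₁ i) i′<i)
    ...   | ‵inject₁ j = j , to inject₁-<-inject₁ i′<i , trans (sym (∷ʳ-inject₁ f a j)) e

    growth-last : RestrictedGrowth (f ∷ʳ a) → ∀ l → l < a → ∃ λ i → f i ≡ l
    growth-last growth l l<a with growth (fromℕ m) l (subst (l <_) (sym (∷ʳ-fromℕ f a)) l<a)
    ... | i′ , i′<v , e with view i′
    ...   | ‵fromℕ     = ⊥-elim (<-irrefl refl i′<v)
    ...   | ‵inject₁ j = j , trans (sym (∷ʳ-inject₁ f a j)) e

    from′ : RestrictedGrowth f × (∀ l → l < a → ∃ λ i → f i ≡ l) → RestrictedGrowth (f ∷ʳ a)
    from′ (growth , below) i l l<ci with view i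
    ... | ‵fromℕ =
      let j , e = below l (subst (l <_) (∷ʳ-fromℕ f a) l<ci)
      in inject₁ j , inject₁<fromℕ j , trans (∷ʳ-inject₁ f a j) e
    ... | ‵inject₁ j =
      let j′ , j′<j , e = growth j l (subst (l <_) (∷ʳ-inject₁ f a j) l<ci)
      in inject₁ j′ , from inject₁-<-inject₁ j′<j , trans (∷ʳ-inject₁ f a j′) e

  proper-∷ʳ : (H′ : Graph (suc m)) → Proper H′ (f ∷ʳ a) ⇔ (Proper (deleteLast H′) f × Free H′ f a)
  proper-∷ʳ H′ = mk⇔ to′ from′
    where
    to′ : Proper H′ (f ∷ʳ a) → Proper (deleteLast H′) f × Free H′ f a
    to′ p = (λ i j t e → p (inject₁ i) (inject₁ j) t
                           (subst₂ _≡_ (sym (∷ʳ-inject₁ f a i)) (sym (∷ʳ-inject₁ f a j)) e))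
          , (λ i t e → p (fromℕ m) (inject₁ i) t
                         (subst₂ _≡_ (sym (∷ʳ-fromℕ f a)) (sym (∷ʳ-inject₁ f a i)) (sym e)))

    from′ : Proper (deleteLast H′) f × Free H′ f a → Proper H′ (f ∷ʳ a)
    from′ (p , free) i j t e with view i | view j
    ... | ‵fromℕ      | ‵fromℕ      = subst T (irrefl H′ (fromℕ m)) t
    ... | ‵fromℕ      | ‵inject₁ j′ = free j′ t (sym (subst₂ _≡_ (∷ʳ-fromℕ f a) (∷ʳ-inject₁ f a j′) e))
    ... | ‵inject₁ i′ | ‵fromℕ      = free i′ (subst T (Graph.sym H′ (inject₁ i′) (fromℕ m)) t)
                                             (subst₂ _≡_ (∷ʳ-inject₁ f a i′) (∷ʳ-fromℕ f a) e)
    ... | ‵inject₁ i′ | ‵inject₁ j′ = p i′ j′ t (subst₂ _≡_ (∷ʳ-inject₁ f a i′) (∷ʳ-inject₁ f a j′) e)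

onto? : ∀ {m k} (f : Fin m → Fin k) → Dec (Onto f)
onto? f = map′ (to (onto-reflects f)) (from (onto-reflects f)) (T? (surjective? f))

missing-label : ∀ {m k} (f : Fin m → Fin k) → ¬ Onto f → ∃ λ l → ∀ i → f i ≢ l
missing-label f ¬onto =
  let l , unhit = ¬∀⟶∃¬ _ _ (λ l → any? λ i → f i ≟ l) ¬onto in l , λ i e → unhit (i , e)

missing-∷ʳ : ∀ {m k} {f : Fin m → Fin k} {a} → ¬ Onto f → Onto (f ∷ʳ a) → ∀ i → f i ≢ a
missing-∷ʳ {f = f} ¬onto onto i fi≡a with missing-label f ¬onto
... | l , unhit with to onto-∷ʳ onto l
...   | inj₁ (j , fj≡l) = unhit j fj≡l
...   | inj₂ a≡l        = unhit i (trans fi≡a a≡l)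

newLabel-∷ʳ : ∀ {m k} {f : Fin m → Fin (suc k)} {a} → Onto (f ∷ʳ a) → RestrictedGrowth (f ∷ʳ a) →
              (∀ i → f i ≢ a) → a ≡ fromℕ k
newLabel-∷ʳ {k = k} {a = a} onto growth unhit with a ≟ fromℕ k
... | yes a≡top = a≡top
... | no  a≢top with to onto-∷ʳ onto (fromℕ k)
...   | inj₂ a≡top        = ⊥-elim (a≢top a≡top)
...   | inj₁ (i , fi≡top) =
  let a<fi = subst (a <_) (sym fi≡top) (≤∧≢⇒< (≤fromℕ a) a≢top)
      j , _ , fj≡a = proj₁ (to restrictedGrowth-∷ʳ growth) i a a<fi
  in ⊥-elim (unhit j fj≡a)

restrictedGrowth-inject₁ : ∀ {m k} {g : Fin m → Fin k} → RestrictedGrowth (inject₁ ∘ g) ⇔ RestrictedGrowth g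
restrictedGrowth-inject₁ {g = g} = mk⇔ to′ from′
  where
  to′ : RestrictedGrowth (inject₁ ∘ g) → RestrictedGrowth g
  to′ growth i l l<gi =
    let i′ , i′<i , e = growth i (inject₁ l) (from inject₁-<-inject₁ l<gi) in i′ , i′<i , inject₁-injective e

  from′ : RestrictedGrowth g → RestrictedGrowth (inject₁ ∘ g)
  from′ growth i l l<gi with view l
  ... | ‵fromℕ      = ⊥-elim (fromℕ≮ _ l<gi)
  ... | ‵inject₁ l′ =
    let i′ , i′<i , e = growth i l′ (to inject₁-<-inject₁ l<gi) in i′ , i′<i , cong inject₁ e

stablePartition-∷ʳ-onto : ∀ {m k} (H′ : Graph (suc m)) {f : Fin m → Fin k} {a} → Onto f →
                          StablePartition H′ (f ∷ʳ a) ⇔ (StablePartition (deleteLast H′) f × Free H′ f a)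
stablePartition-∷ʳ-onto H′ onto = mk⇔
  (λ (_ , growth , proper) → let proper′ , free = to (proper-∷ʳ H′) proper
                             in (onto , proj₁ (to restrictedGrowth-∷ʳ growth) , proper′) , free)
  (λ ((_ , growth , proper) , free) → from onto-∷ʳ (inj₁ ∘ onto) ,
                                      from restrictedGrowth-∷ʳ (growth , λ l _ → onto l) ,
                                      from (proper-∷ʳ H′) (proper , free))

stablePartition-∷ʳ-new : ∀ {m k} (H′ : Graph (suc m)) {g : Fin m → Fin k} →
                         StablePartition H′ ((inject₁ ∘ g) ∷ʳ fromℕ k) ⇔ StablePartition (deleteLast H′) g
stablePartition-∷ʳ-new {k = k} H′ {g} = mk⇔ to′ from′
  where
  to′ : StablePartition H′ ((inject₁ ∘ g) ∷ʳ fromℕ k) → StablePartition (deleteLast H′) g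
  to′ (onto , growth , proper) = onto′ , to restrictedGrowth-inject₁ (proj₁ (to restrictedGrowth-∷ʳ growth)) ,
                                 λ i j t gi≡gj → proj₁ (to (proper-∷ʳ H′) proper) i j t (cong inject₁ gi≡gj)
    where
    onto′ : Onto g
    onto′ l with to onto-∷ʳ onto (inject₁ l)
    ... | inj₁ (i , e) = i , inject₁-injective e
    ... | inj₂ top≡l   = ⊥-elim (fromℕ≢inject₁ top≡l)

  hit : Onto g → ∀ l → l ≢ fromℕ k → ∃ λ i → inject₁ (g i) ≡ l
  hit onto l l≢top with view l
  ... | ‵fromℕ      = ⊥-elim (l≢top refl)
  ... | ‵inject₁ l′ = proj₁ (onto l′) , cong inject₁ (proj₂ (onto l′))

  from′ : StablePartition (deleteLast H′) g → StablePartition H′ ((inject₁ ∘ g) ∷ʳ fromℕ k)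
  from′ (onto , growth , proper) =
    from onto-∷ʳ case-top ,
    from restrictedGrowth-∷ʳ (from restrictedGrowth-inject₁ growth , λ l l<top → hit onto l (<⇒≢ l<top)) ,
    from (proper-∷ʳ H′) ((λ i j t e → proper i j t (inject₁-injective e)) , λ i t e → fromℕ≢inject₁ (sym e))
    where
    case-top : ∀ l → (∃ λ i → inject₁ (g i) ≡ l) ⊎ fromℕ k ≡ l
    case-top l with l ≟ fromℕ k
    ... | yes l≡top = inj₂ (sym l≡top)
    ... | no  l≢top = inj₁ (hit onto l l≢top)

-- A new vertex whose neighbourhood is a clique

Recurrence : ∀ {m′ m} → ℕ → Graph m′ → Graph m → Set
Recurrence d H′ H = ∀ k → S H′ (suc k) ≡ S H k + (suc k ∸ d) * S H (suc k)

module _ {m} (H′ : Graph (suc m)) (us : List (Fin m))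
         (neighbours : ∀ i → T (adj H′ (fromℕ m) (inject₁ i)) ⇔ i ∈ us)
         (clique : AllPairs (λ u w → T (adj H′ (inject₁ u) (inject₁ w))) us) where

  private
    H : Graph m
    H = deleteLast H′

  free⇔∉ : ∀ {k} {f : Fin m → Fin k} {a} → Free H′ f a ⇔ a ∉ map f us
  free⇔∉ {f = f} = mk⇔
    (λ free a∈ → let u , u∈us , a≡fu = ∈-map⁻ f a∈ in free u (from (neighbours u) u∈us) (sym a≡fu))
    (λ a∉ i t fi≡a → a∉ (subst (_∈ map f us) fi≡a (∈-map⁺ f (to (neighbours i) t))))

  ∑-free : ∀ {K} {f : Fin m → Fin K} → Proper H f → ∑[ a < K ] ind (does (a ∉? map f us)) ≡ K ∸ length us
  ∑-free {K} {f} proper = begin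
    free-count                                    ≡⟨ m+n∸n≡m free-count (length us) ⟨
    free-count + length us ∸ length us            ≡⟨ cong (λ n → free-count + n ∸ length us) (length-map f us) ⟨
    free-count + length (map f us) ∸ length us    ≡⟨ cong (_∸ length us) (∑-∉ (map f us) colours-unique) ⟩
    K ∸ length us                                 ∎
    where
    open ≡-Reasoning
    free-count : ℕ
    free-count = ∑[ a < K ] ind (does (a ∉? map f us))

    colours-unique : Unique (map f us)
    colours-unique = AllPairs.map⁺ (AllPairs.map (λ {u} {w} → proper u w) clique)

  ind-∷ʳ-onto : ∀ {k} {f : Fin m → Fin k} → Onto f → ∀ a →
                ind (isStablePartition H′ (f ∷ʳ a)) ≡ ind (isStablePartition H f) * ind (does (a ∉? map f us))
  ind-∷ʳ-onto {f = f} onto a =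
    trans (ind-cong (mk⇔ to′ from′)) (ind-∧ (isStablePartition H f) (does (a ∉? map f us)))
    where
    to′ : T (isStablePartition H′ (f ∷ʳ a)) → T (isStablePartition H f ∧ does (a ∉? map f us))
    to′ t = let p , free = to (stablePartition-∷ʳ-onto H′ onto) (to (stablePartition-reflects H′ _) t)
            in from T-∧ (from (stablePartition-reflects H f) p , from (T-does (a ∉? map f us)) (to free⇔∉ free))

    from′ : T (isStablePartition H f ∧ does (a ∉? map f us)) → T (isStablePartition H′ (f ∷ʳ a))
    from′ t = let p , a∉ = to (T-∧ {isStablePartition H f}) t
              in from (stablePartition-reflects H′ _) (from (stablePartition-∷ʳ-onto H′ onto)
                   (to (stablePartition-reflects H f) p , from free⇔∉ (to (T-does (a ∉? map f us)) a∉)))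

  -- The new vertex is a singleton block of `f ∷ʳ a` iff `f` misses a label, and then `a` is the top one.
  newBlock? : ∀ {k} → (Fin m → Fin (suc k)) → Bool
  newBlock? {k} f = isStablePartition H′ (f ∷ʳ fromℕ k) ∧ not (surjective? f)

  ∑-extensions : ∀ {k} (f : Fin m → Fin (suc k)) →
                 ∑[ a < suc k ] ind (isStablePartition H′ (f ∷ʳ a)) ≡
                 (suc k ∸ length us) * ind (isStablePartition H f) + ind (newBlock? f)
  ∑-extensions {k} f with onto? f
  ... | yes onto = begin
    ∑[ a < suc k ] ind (isStablePartition H′ (f ∷ʳ a))
      ≡⟨ sum-cong-≗ (ind-∷ʳ-onto onto) ⟩
    ∑[ a < suc k ] (ind (isStablePartition H f) * ind (does (a ∉? map f us)))
      ≡⟨ *-distribˡ-sum (ind (isStablePartition H f)) (λ a → ind (does (a ∉? map f us))) ⟨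
    ind (isStablePartition H f) * ∑[ a < suc k ] ind (does (a ∉? map f us))
      ≡⟨ ind-*-cong (λ t → ∑-free (proj₂ (proj₂ (to (stablePartition-reflects H f) t)))) ⟩
    ind (isStablePartition H f) * (suc k ∸ length us)
      ≡⟨ *-comm (ind (isStablePartition H f)) _ ⟩
    (suc k ∸ length us) * ind (isStablePartition H f)
      ≡⟨ +-identityʳ _ ⟨
    (suc k ∸ length us) * ind (isStablePartition H f) + 0
      ≡⟨ cong ((suc k ∸ length us) * ind (isStablePartition H f) +_) (ind-false λ t →
           to T-not (proj₂ (to (T-∧ {isStablePartition H′ (f ∷ʳ fromℕ k)}) t)) (from (onto-reflects f) onto)) ⟨
    (suc k ∸ length us) * ind (isStablePartition H f) + ind (newBlock? f) ∎
    where open ≡-Reasoning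
  ... | no ¬onto = begin
    ∑[ a < suc k ] ind (isStablePartition H′ (f ∷ʳ a))
      ≡⟨ ∑-single _ (fromℕ k) (λ a a≢top → ind-false (a≢top ∘ new-label ∘ to (stablePartition-reflects H′ _))) ⟩
    ind (isStablePartition H′ (f ∷ʳ fromℕ k))
      ≡⟨ ind-cong (mk⇔ (λ t → from T-∧ (t , from T-not (¬onto ∘ to (onto-reflects f)))) (proj₁ ∘ to T-∧)) ⟩
    ind (newBlock? f)
      ≡⟨ cong (_+ ind (newBlock? f)) (*-zeroʳ (suc k ∸ length us)) ⟨
    (suc k ∸ length us) * 0 + ind (newBlock? f)
      ≡⟨ cong (λ n → (suc k ∸ length us) * n + ind (newBlock? f))
              (ind-false (¬onto ∘ proj₁ ∘ to (stablePartition-reflects H f))) ⟨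
    (suc k ∸ length us) * ind (isStablePartition H f) + ind (newBlock? f) ∎
    where
    open ≡-Reasoning
    new-label : ∀ {a} → StablePartition H′ (f ∷ʳ a) → a ≡ fromℕ k
    new-label (onto , growth , _) = newLabel-∷ʳ onto growth (missing-∷ʳ ¬onto onto)

  newBlock-cong : ∀ {k} → (ind ∘ newBlock? {k}) Preserves _≗_ ⟶ _≡_
  newBlock-cong {k} f≗g = cong ind (cong₂ _∧_
    (isStablePartition-cong {H = H′} {H′} (λ _ _ → refl) (∷ʳ-cong (fromℕ k) f≗g))
    (cong not (surjective?-cong f≗g)))

  newBlock-vanish : ∀ {k} (f : Fin m → Fin (suc k)) i → f i ≡ fromℕ k → ind (newBlock? f) ≡ 0
  newBlock-vanish {k} f i fi≡top = ind-false λ t →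
    let p , not-onto = to (T-∧ {isStablePartition H′ (f ∷ʳ fromℕ k)}) t
        onto , _ = to (stablePartition-reflects H′ _) p
    in missing-∷ʳ (to T-not not-onto ∘ from (onto-reflects f)) onto i fi≡top

  newBlock-inject₁ : ∀ {k} (g : Fin m → Fin k) → newBlock? (inject₁ ∘ g) ≡ isStablePartition H g
  newBlock-inject₁ {k} g = T-ext to′ from′
    where
    to′ : T (newBlock? (inject₁ ∘ g)) → T (isStablePartition H g)
    to′ t = from (stablePartition-reflects H g) (to (stablePartition-∷ʳ-new H′) (to (stablePartition-reflects H′ _)
              (proj₁ (to (T-∧ {isStablePartition H′ ((inject₁ ∘ g) ∷ʳ fromℕ k)}) t))))

    not-onto : ¬ Onto (inject₁ ∘ g)
    not-onto onto = let i , e = onto (fromℕ k) in fromℕ≢inject₁ (sym e)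

    from′ : T (isStablePartition H g) → T (newBlock? (inject₁ ∘ g))
    from′ t = from T-∧ (from (stablePartition-reflects H′ _) (from (stablePartition-∷ʳ-new H′)
                         (to (stablePartition-reflects H g) t)) ,
                       from T-not (not-onto ∘ to (onto-reflects (inject₁ ∘ g))))

  recurrence-deleteLast : Recurrence (length us) H′ H
  recurrence-deleteLast k = begin
    S H′ (suc k)
      ≡⟨ S≡sumFuns H′ (suc k) ⟩
    sumFuns (suc m) (suc k) (ind ∘ isStablePartition H′)
      ≡⟨ sumFuns-∷ʳ m (suc k) (ind-isStablePartition-cong H′) ⟩
    sumFuns m (suc k) (λ f → ∑[ a < suc k ] ind (isStablePartition H′ (f ∷ʳ a)))
      ≡⟨ sumFuns-cong m (suc k) ∑-extensions ⟩
    sumFuns m (suc k) (λ f → c * ind (isStablePartition H f) + ind (newBlock? f))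
      ≡⟨ sumFuns-+ m (suc k) _ _ ⟩
    sumFuns m (suc k) (λ f → c * ind (isStablePartition H f)) + sumFuns m (suc k) (ind ∘ newBlock?)
      ≡⟨ cong₂ _+_ (sumFuns-*ˡ m (suc k) c _) (sumFuns-inject₁ m k newBlock-cong newBlock-vanish) ⟩
    c * sumFuns m (suc k) (ind ∘ isStablePartition H) + sumFuns m k (λ g → ind (newBlock? (inject₁ ∘ g)))
      ≡⟨ cong₂ (λ x y → c * x + y) (sym (S≡sumFuns H (suc k)))
               (trans (sumFuns-cong m k (cong ind ∘ newBlock-inject₁)) (sym (S≡sumFuns H k))) ⟩
    c * S H (suc k) + S H k
      ≡⟨ +-comm (c * S H (suc k)) (S H k) ⟩
    S H k + c * S H (suc k) ∎
    where
    open ≡-Reasoning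
    c = suc k ∸ length us

-- Unions with complete graphs

data Split (m n : ℕ) : Fin (m + n) → Set where
  left  : (i : Fin m) → Split m n (i ↑ˡ n)
  right : (t : Fin n) → Split m n (m ↑ʳ t)

split : ∀ m n (x : Fin (m + n)) → Split m n x
split m n x with splitAt m x in eq
... | inj₁ i = subst (Split m n) (splitAt⁻¹-↑ˡ eq) (left i)
... | inj₂ t = subst (Split m n) (splitAt⁻¹-↑ʳ eq) (right t)

↑ˡ≢↑ʳ : ∀ {m n} (i : Fin m) (t : Fin n) → i ↑ˡ n ≢ m ↑ʳ t
↑ˡ≢↑ʳ {m} {n} i t e with trans (sym (splitAt-↑ˡ m i n)) (trans (cong (splitAt m) e) (splitAt-↑ʳ m n t))
... | ()

module _ {m n} (G : Graph m) (H : Graph n) where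

  ∪-adj-↑ˡ-↑ˡ : ∀ i j → adj (G ∪ H) (i ↑ˡ n) (j ↑ˡ n) ≡ adj G i j
  ∪-adj-↑ˡ-↑ˡ i j rewrite splitAt-↑ˡ m i n | splitAt-↑ˡ m j n = refl

  ∪-adj-↑ˡ-↑ʳ : ∀ i j → adj (G ∪ H) (i ↑ˡ n) (m ↑ʳ j) ≡ false
  ∪-adj-↑ˡ-↑ʳ i j rewrite splitAt-↑ˡ m i n | splitAt-↑ʳ m n j = refl

  ∪-adj-↑ʳ-↑ˡ : ∀ i j → adj (G ∪ H) (m ↑ʳ i) (j ↑ˡ n) ≡ false
  ∪-adj-↑ʳ-↑ˡ i j rewrite splitAt-↑ʳ m n i | splitAt-↑ˡ m j n = refl

  ∪-adj-↑ʳ-↑ʳ : ∀ i j → adj (G ∪ H) (m ↑ʳ i) (m ↑ʳ j) ≡ adj H i j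
  ∪-adj-↑ʳ-↑ʳ i j rewrite splitAt-↑ʳ m n i | splitAt-↑ʳ m n j = refl

T-neq : ∀ {r} {t s : Fin r} → T (neq t s) ⇔ t ≢ s
T-neq {t = t} {s} = mk⇔ (λ u → to T-not u ∘ fromWitness) (λ t≢s → from T-not (t≢s ∘ toWitness))

neq-inject₁ : ∀ {r} (t s : Fin r) → neq (inject₁ t) (inject₁ s) ≡ neq t s
neq-inject₁ t s = T-ext (λ u → from T-neq (to T-neq u ∘ cong inject₁))
                        (λ u → from T-neq (to T-neq u ∘ inject₁-injective))

S-∪K₀ : ∀ {m} (H : Graph m) k → S (H ∪ K 0) k ≡ S H k
S-∪K₀ {m} H k = trans (sym (S-reindex-cast m≡m+0 (H ∪ K 0) k))
  (S-cong (λ i j → trans (cong₂ (adj (H ∪ K 0)) (cast-↑ˡ i) (cast-↑ˡ j)) (∪-adj-↑ˡ-↑ˡ H (K 0) i j)) k)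
  where
  m≡m+0 : m ≡ m + 0
  m≡m+0 = sym (+-identityʳ m)
  cast-↑ˡ : ∀ i → cast m≡m+0 i ≡ i ↑ˡ 0
  cast-↑ˡ i = toℕ-injective (trans (toℕ-cast m≡m+0 i) (sym (toℕ-↑ˡ i 0)))

module _ {m} (H : Graph m) (r : ℕ) where

  private
    ι : Fin (suc (m + r)) → Fin (m + suc r)
    ι = cast (sym (+-suc m r))

    H⁺ : Graph (suc (m + r))
    H⁺ = reindex ι (H ∪ K (suc r))

    toℕ-ι-inject₁ : ∀ x → toℕ (ι (inject₁ x)) ≡ toℕ x
    toℕ-ι-inject₁ x = trans (toℕ-cast _ (inject₁ x)) (toℕ-inject₁ x)

    ι-inject₁-↑ˡ : ∀ i → ι (inject₁ (i ↑ˡ r)) ≡ i ↑ˡ suc r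
    ι-inject₁-↑ˡ i = toℕ-injective (trans (toℕ-ι-inject₁ (i ↑ˡ r)) (trans (toℕ-↑ˡ i r) (sym (toℕ-↑ˡ i (suc r)))))

    ι-inject₁-↑ʳ : ∀ t → ι (inject₁ (m ↑ʳ t)) ≡ m ↑ʳ inject₁ t
    ι-inject₁-↑ʳ t = toℕ-injective (trans (toℕ-ι-inject₁ (m ↑ʳ t))
      (trans (toℕ-↑ʳ m t) (trans (cong (m +_) (sym (toℕ-inject₁ t))) (sym (toℕ-↑ʳ m (inject₁ t))))))

    ι-fromℕ : ι (fromℕ (m + r)) ≡ m ↑ʳ fromℕ r
    ι-fromℕ = toℕ-injective (trans (toℕ-cast _ (fromℕ (m + r)))
      (trans (toℕ-fromℕ (m + r)) (trans (cong (m +_) (sym (toℕ-fromℕ r))) (sym (toℕ-↑ʳ m (fromℕ r))))))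

    deleteLast-H⁺ : ∀ x y → adj (deleteLast H⁺) x y ≡ adj (H ∪ K r) x y
    deleteLast-H⁺ x y with split m r x | split m r y
    ... | left i  | left j  = trans (cong₂ (adj (H ∪ K (suc r))) (ι-inject₁-↑ˡ i) (ι-inject₁-↑ˡ j))
                                    (trans (∪-adj-↑ˡ-↑ˡ H _ i j) (sym (∪-adj-↑ˡ-↑ˡ H _ i j)))
    ... | left i  | right s = trans (cong₂ (adj (H ∪ K (suc r))) (ι-inject₁-↑ˡ i) (ι-inject₁-↑ʳ s))
                                    (trans (∪-adj-↑ˡ-↑ʳ H _ i _) (sym (∪-adj-↑ˡ-↑ʳ H _ i s)))
    ... | right t | left j  = trans (cong₂ (adj (H ∪ K (suc r))) (ι-inject₁-↑ʳ t) (ι-inject₁-↑ˡ j))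
                                    (trans (∪-adj-↑ʳ-↑ˡ H _ _ j) (sym (∪-adj-↑ʳ-↑ˡ H _ t j)))
    ... | right t | right s = trans (cong₂ (adj (H ∪ K (suc r))) (ι-inject₁-↑ʳ t) (ι-inject₁-↑ʳ s))
                                    (trans (∪-adj-↑ʳ-↑ʳ H _ _ _)
                                           (trans (neq-inject₁ t s) (sym (∪-adj-↑ʳ-↑ʳ H _ t s))))

    us : List (Fin (m + r))
    us = tabulate (m ↑ʳ_)

    neighbours : ∀ x → T (adj H⁺ (fromℕ (m + r)) (inject₁ x)) ⇔ x ∈ us
    neighbours x with split m r x
    ... | left i  = mk⇔ (λ t → ⊥-elim (subst T adj≡false t))
                        (λ i∈us → let t , e = ∈-tabulate⁻ i∈us in ⊥-elim (↑ˡ≢↑ʳ i t e))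
      where
      adj≡false : adj H⁺ (fromℕ (m + r)) (inject₁ (i ↑ˡ r)) ≡ false
      adj≡false = trans (cong₂ (adj (H ∪ K (suc r))) ι-fromℕ (ι-inject₁-↑ˡ i)) (∪-adj-↑ʳ-↑ˡ H _ _ i)
    ... | right t = mk⇔ (λ _ → ∈-tabulate⁺ t) (λ _ → subst T (sym adj≡neq) (from T-neq fromℕ≢inject₁))
      where
      adj≡neq : adj H⁺ (fromℕ (m + r)) (inject₁ (m ↑ʳ t)) ≡ neq (fromℕ r) (inject₁ t)
      adj≡neq = trans (cong₂ (adj (H ∪ K (suc r))) ι-fromℕ (ι-inject₁-↑ʳ t)) (∪-adj-↑ʳ-↑ʳ H _ _ _)

    clique : AllPairs (λ u w → T (adj H⁺ (inject₁ u) (inject₁ w))) us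
    clique = AllPairs.tabulate⁺ λ {t} {s} t≢s →
      subst T (sym (trans (deleteLast-H⁺ (m ↑ʳ t) (m ↑ʳ s)) (∪-adj-↑ʳ-↑ʳ H (K r) t s))) (from T-neq t≢s)

  recurrence-∪K : Recurrence r (H ∪ K (suc r)) (H ∪ K r)
  recurrence-∪K k = begin
    S (H ∪ K (suc r)) (suc k)
      ≡⟨ S-reindex-cast (sym (+-suc m r)) (H ∪ K (suc r)) (suc k) ⟨
    S H⁺ (suc k)
      ≡⟨ recurrence-deleteLast H⁺ us neighbours clique k ⟩
    S (deleteLast H⁺) k + (suc k ∸ length us) * S (deleteLast H⁺) (suc k)
      ≡⟨ cong₂ (λ x y → x + (suc k ∸ length us) * y) (S-cong {H = deleteLast H⁺} deleteLast-H⁺ k)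
                                                      (S-cong {H = deleteLast H⁺} deleteLast-H⁺ (suc k)) ⟩
    S (H ∪ K r) k + (suc k ∸ length us) * S (H ∪ K r) (suc k)
      ≡⟨ cong (λ d → S (H ∪ K r) k + (suc k ∸ d) * S (H ∪ K r) (suc k)) (length-tabulate {n = r} (m ↑ʳ_)) ⟩
    S (H ∪ K r) k + (suc k ∸ r) * S (H ∪ K r) (suc k) ∎
    where open ≡-Reasoning

recurrence-∪K₁ : ∀ {m} (H : Graph m) → Recurrence 0 (H ∪ K 1) H
recurrence-∪K₁ H k = trans (recurrence-∪K H 0 k) (cong₂ (λ x y → x + suc k * y) (S-∪K₀ H k) (S-∪K₀ H (suc k)))

-- Weighted sums

sum1to-cong : ∀ N {f g : ℕ → ℕ} → (∀ k → f (suc k) ≡ g (suc k)) → sum1to N f ≡ sum1to N g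
sum1to-cong zero    f≡g = refl
sum1to-cong (suc N) f≡g = cong₂ _+_ (sum1to-cong N f≡g) (f≡g N)

sum1to-+ : ∀ N (f g : ℕ → ℕ) → sum1to N (λ k → f k + g k) ≡ sum1to N f + sum1to N g
sum1to-+ zero    f g = refl
sum1to-+ (suc N) f g = trans (cong (_+ (f (suc N) + g (suc N))) (sum1to-+ N f g))
                             (interchange (sum1to N f) (sum1to N g) (f (suc N)) (g (suc N)))

sum1to-suc : ∀ N (f : ℕ → ℕ) → sum1to (suc N) f ≡ f 1 + sum1to N (f ∘ suc)
sum1to-suc zero    f = sym (+-identityʳ (f 1))
sum1to-suc (suc N) f = trans (cong (_+ f (suc (suc N))) (sum1to-suc N f)) (+-assoc (f 1) _ _)

weightStep : ℕ → (ℕ → ℕ) → ℕ → ℕ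
weightStep d w k = w (suc k) + (k ∸ d) * w k

-- `H` is nonempty so that `S H 0 ≡ 0`: this is where the theorem needs `1 ≤ n`.
weighted-sum-step : ∀ {m′ m} {H′ : Graph m′} {H : Graph (suc m)} d w →
                    m′ ≡ suc (suc m) → Recurrence d H′ H →
                    sum1to m′ (λ j → w j * S H′ j) ≡ sum1to (suc m) (λ k → weightStep d w k * S H k)
weighted-sum-step {m = m} {H′} {H} d w refl rec = begin
  sum1to (2 + m) (λ j → w j * S H′ j)
    ≡⟨ sum1to-cong (2 + m) expand ⟩
  sum1to (2 + m) (λ j → w j * S H (pred j) + (j ∸ d) * w j * S H j)
    ≡⟨ sum1to-+ (2 + m) (λ j → w j * S H (pred j)) (λ j → (j ∸ d) * w j * S H j) ⟩
  sum1to (2 + m) (λ j → w j * S H (pred j)) + sum1to (2 + m) (λ j → (j ∸ d) * w j * S H j)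
    ≡⟨ cong₂ _+_ shift drop-top ⟩
  sum1to (1 + m) (λ k → w (suc k) * S H k) + sum1to (1 + m) (λ k → (k ∸ d) * w k * S H k)
    ≡⟨ sum1to-+ (1 + m) (λ k → w (suc k) * S H k) (λ k → (k ∸ d) * w k * S H k) ⟨
  sum1to (1 + m) (λ k → w (suc k) * S H k + (k ∸ d) * w k * S H k)
    ≡⟨ sum1to-cong (1 + m) (λ k → *-distribʳ-+ (S H (suc k)) (w (suc (suc k))) ((suc k ∸ d) * w (suc k))) ⟨
  sum1to (1 + m) (λ k → weightStep d w k * S H k) ∎
  where
  open ≡-Reasoning
  expand : ∀ k → w (suc k) * S H′ (suc k) ≡ w (suc k) * S H k + (suc k ∸ d) * w (suc k) * S H (suc k)
  expand k = begin
    w (suc k) * S H′ (suc k)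
      ≡⟨ cong (w (suc k) *_) (rec k) ⟩
    w (suc k) * (S H k + (suc k ∸ d) * S H (suc k))
      ≡⟨ *-distribˡ-+ (w (suc k)) _ _ ⟩
    w (suc k) * S H k + w (suc k) * ((suc k ∸ d) * S H (suc k))
      ≡⟨ cong (w (suc k) * S H k +_) (*-assoc (w (suc k)) _ _) ⟨
    w (suc k) * S H k + w (suc k) * (suc k ∸ d) * S H (suc k)
      ≡⟨ cong (λ x → w (suc k) * S H k + x * S H (suc k)) (*-comm (w (suc k)) _) ⟩
    w (suc k) * S H k + (suc k ∸ d) * w (suc k) * S H (suc k) ∎

  shift : sum1to (2 + m) (λ j → w j * S H (pred j)) ≡ sum1to (1 + m) (λ k → w (suc k) * S H k)
  shift = trans (sum1to-suc (1 + m) (λ j → w j * S H (pred j)))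
                (cong (_+ sum1to (1 + m) (λ k → w (suc k) * S H k))
                      (trans (cong (w 1 *_) (S-zero H)) (*-zeroʳ (w 1))))

  top-vanishes : (2 + m ∸ d) * w (2 + m) * S H (2 + m) ≡ 0
  top-vanishes = trans (cong ((2 + m ∸ d) * w (2 + m) *_) (S-beyond H (2 + m) (n<1+n (suc m))))
                       (*-zeroʳ ((2 + m ∸ d) * w (2 + m)))

  drop-top : sum1to (2 + m) (λ j → (j ∸ d) * w j * S H j) ≡ sum1to (1 + m) (λ k → (k ∸ d) * w k * S H k)
  drop-top = trans (cong (sum1to (1 + m) (λ k → (k ∸ d) * w k * S H k) +_) top-vanishes) (+-identityʳ _)

weight₄ : (ℕ → ℕ) → ℕ → ℕ
weight₄ w = weightStep 0 (weightStep 1 (weightStep 2 (weightStep 0 w)))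

weighted-sum-G∪K₃∪K₁ : ∀ {p} (G : Graph (suc p)) w →
                       sum1to (suc p + 3 + 1) (λ j → w j * S (G ∪ K 3 ∪ K 1) j) ≡
                       sum1to (suc p) (λ k → weight₄ w k * S G k)
weighted-sum-G∪K₃∪K₁ {p} G w =
  trans (weighted-sum-step 0 w (+-comm (suc p + 3) 1) (recurrence-∪K₁ (G ∪ K 3))) (
  trans (weighted-sum-step 2 w₁ (cong suc (+-suc p 2)) (recurrence-∪K G 2)) (
  trans (weighted-sum-step 1 w₂ (cong suc (+-suc p 1)) (recurrence-∪K G 1))
        (weighted-sum-step 0 w₃ (+-comm (suc p) 1) (recurrence-∪K₁ G))))
  where
  w₁ w₂ w₃ : ℕ → ℕ
  w₁ = weightStep 0 w
  w₂ = weightStep 2 w₁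
  w₃ = weightStep 1 w₂

-- `w₂` has its closed form only from 2 on, where `k ∸ 2` does not truncate; `w₃ 1` uses `w₂ 1` only
-- with the coefficient `1 ∸ 1 = 0`, so it is computed directly.
module _ where
  open +-*-Solver

  weight₄-𝓑 : ∀ x → weight₄ (λ _ → 1) (suc x) ≡ suc x ^ 4 + suc x ^ 3 + 5 * suc x ^ 2 + 6 * suc x + 4
  weight₄-𝓑 x = trans (cong₂ (λ a b → a + suc x * b) (w₃ (suc x)) (w₃ x))
    (solve 1 (λ k → ((con 1 :+ k) :^ 3 :+ con 2 :* (con 1 :+ k) :+ con 1) :+ k :* (k :^ 3 :+ con 2 :* k :+ con 1)
                    := k :^ 4 :+ k :^ 3 :+ con 5 :* k :^ 2 :+ con 6 :* k :+ con 4) refl (suc x))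
    where
    w₂ : ∀ y → weightStep 2 (weightStep 0 (λ _ → 1)) (2 + y) ≡ (2 + y) ^ 2
    w₂ = solve 1 (λ y → (con 1 :+ (con 3 :+ y) :* con 1) :+ y :* (con 1 :+ (con 2 :+ y) :* con 1)
                        := (con 2 :+ y) :^ 2) refl

    w₃ : ∀ x → weightStep 1 (weightStep 2 (weightStep 0 (λ _ → 1))) (1 + x) ≡ (1 + x) ^ 3 + 2 * (1 + x) + 1
    w₃ zero    = refl
    w₃ (suc y) = trans (cong₂ (λ a b → a + suc y * b) (w₂ (suc y)) (w₂ y))
      (solve 1 (λ y → (con 3 :+ y) :^ 2 :+ (con 1 :+ y) :* (con 2 :+ y) :^ 2
                      := (con 2 :+ y) :^ 3 :+ con 2 :* (con 2 :+ y) :+ con 1) refl y)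

  weight₄-𝓣 : ∀ x → weight₄ (λ k → k) (suc x) ≡
              suc x ^ 5 + suc x ^ 4 + 9 * suc x ^ 3 + 15 * suc x ^ 2 + 21 * suc x + 13
  weight₄-𝓣 x = trans (cong₂ (λ a b → a + suc x * b) (w₃ (suc x)) (w₃ x))
    (solve 1 (λ k → ((con 1 :+ k) :^ 4 :+ con 5 :* (con 1 :+ k) :^ 2 :+ con 4 :* (con 1 :+ k) :+ con 3)
                    :+ k :* (k :^ 4 :+ con 5 :* k :^ 2 :+ con 4 :* k :+ con 3)
                    := k :^ 5 :+ k :^ 4 :+ con 9 :* k :^ 3 :+ con 15 :* k :^ 2 :+ con 21 :* k :+ con 13) refl (suc x))
    where
    w₂ : ∀ y → weightStep 2 (weightStep 0 (λ k → k)) (2 + y) ≡ (2 + y) ^ 3 + 2 * (2 + y) + 1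
    w₂ = solve 1 (λ y → ((con 4 :+ y) :+ (con 3 :+ y) :* (con 3 :+ y))
                        :+ y :* ((con 3 :+ y) :+ (con 2 :+ y) :* (con 2 :+ y))
                        := (con 2 :+ y) :^ 3 :+ con 2 :* (con 2 :+ y) :+ con 1) refl

    w₃ : ∀ x → weightStep 1 (weightStep 2 (weightStep 0 (λ k → k))) (1 + x) ≡
               (1 + x) ^ 4 + 5 * (1 + x) ^ 2 + 4 * (1 + x) + 3
    w₃ zero    = refl
    w₃ (suc y) = trans (cong₂ (λ a b → a + suc y * b) (w₂ (suc y)) (w₂ y))
      (solve 1 (λ y → ((con 3 :+ y) :^ 3 :+ con 2 :* (con 3 :+ y) :+ con 1)
                      :+ (con 1 :+ y) :* ((con 2 :+ y) :^ 3 :+ con 2 :* (con 2 :+ y) :+ con 1)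
                      := (con 2 :+ y) :^ 4 :+ con 5 :* (con 2 :+ y) :^ 2 :+ con 4 :* (con 2 :+ y) :+ con 3) refl y)

lemma16 : (n : ℕ) → 1 ≤ n → (G : Graph n) →
    (𝓑 (G ∪ K 3 ∪ K 1) ≡ sum1to n (λ k → (k ^ 4 + k ^ 3 + 5 * k ^ 2 + 6 * k + 4) * S G k))
    × (𝓣 (G ∪ K 3 ∪ K 1) ≡ sum1to n (λ k → (k ^ 5 + k ^ 4 + 9 * k ^ 3 + 15 * k ^ 2 + 21 * k + 13) * S G k))
lemma16 (suc p) _ G =
  trans (sum1to-cong (suc p + 3 + 1) (λ k → sym (*-identityˡ _)))
        (trans (weighted-sum-G∪K₃∪K₁ G (λ _ → 1))
               (sum1to-cong (suc p) (λ x → cong (_* S G (suc x)) (weight₄-𝓑 x)))) ,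
  trans (weighted-sum-G∪K₃∪K₁ G (λ k → k))
        (sum1to-cong (suc p) (λ x → cong (_* S G (suc x)) (weight₄-𝓣 x)))
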